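{- Let $Q$ be the graph whose vertices are the sequences in $\{0,1\}^{\mathbb N}$ with finite support, two vertices being adjacent iff they differ in exactly one component, viewed as a structure in the language $\{E\}$ ($E$ the adjacency relation). Let $\widehat\varphi(v;x,y)$ be the formula $E(x,y)\wedge(v=x\vee v=y)$ with object variable $v$ and parameter variables $x,y$, so that $\mathcal S_{\widehat\varphi}$ is the collection of 2-element sets $\{s,s'\}$ with $s,s'$ adjacent in $Q$. Then $\pi_{\widehat\varphi}(t)=\frac12 t\log t\,(1+o(1))$ as $t\to\infty$.
   Context: $\mathcal S_{\widehat\varphi}=\{\widehat\varphi(Q;a,b):a,b\in Q\}$ and $\pi_{\widehat\varphi}(t)=\max\{|\{S\cap A:S\in\mathcal S_{\widehat\varphi}\}|:A\subseteq Q,|A|=t\}$. Here $\log$ denotes the logarithm to base $2$. -}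

module Defs where

open import Data.Nat using (ℕ; _+_; _*_; _∸_; _^_; _≤_; _≥_)
open import Data.Bool using (Bool; true; false)
open import Data.Fin using (Fin)
open import Data.Fin.Subset using (Subset)
open import Data.Vec using (Vec; lookup)
open import Data.Product using (Σ; Σ-syntax; ∃; ∃-syntax; _×_)
open import Data.Sum using (_⊎_)
open import Function.Bundles using (_⇔_)
open import Relation.Binary.PropositionalEquality using (_≡_; _≢_)
open import Relation.Nullary using (¬_)

record Vertex : Set where
  constructor mkVertex
  field
    seq    : ℕ → Bool
    bound  : ℕ
    finite : ∀ m → m ≥ bound → seq m ≡ false
open Vertex public

_≈_ : Vertex → Vertex → Set
v ≈ w = ∀ i → seq v i ≡ seq w i

E : Vertex → Vertex → Set
E v w = Σ[ i ∈ ℕ ] (seq v i ≢ seq w i) × (∀ j → j ≢ i → seq v j ≡ seq w j)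

φ̂ : Vertex → Vertex → Vertex → Set
φ̂ v x y = E x y × (v ≈ x ⊎ v ≈ y)

record TSubset (t : ℕ) : Set where
  constructor mkTSubset
  field
    elt : Fin t → Vertex
    inj : ∀ i j → elt i ≈ elt j → i ≡ j
open TSubset public

-- σ ⊆ A (encoded via A's enumeration) is the trace φ̂(Q; a, b) ∩ A.
IsTrace : ∀ {t} → TSubset t → Vertex → Vertex → Subset t → Set
IsTrace A a b σ = ∀ i → (lookup σ i ≡ true) ⇔ φ̂ (elt A i) a b

Realized : ∀ {t} → TSubset t → Subset t → Set
Realized A σ = Σ[ a ∈ Vertex ] Σ[ b ∈ Vertex ] IsTrace A a b σ

-- |{S ∩ A : S ∈ 𝒮_φ̂}| = m : an enumeration without repetition of all traces.
TraceCount : ∀ {t} → TSubset t → ℕ → Set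
TraceCount {t} A m =
  Σ[ L ∈ Vec (Subset t) m ]
    (∀ i j → lookup L i ≡ lookup L j → i ≡ j) ×
    (∀ i → Realized A (lookup L i)) ×
    (∀ σ → Realized A σ → ∃[ i ] lookup L i ≡ σ)

IsShatterMax : ℕ → ℕ → Set
IsShatterMax t m =
  (Σ[ A ∈ TSubset t ] TraceCount A m) ×
  (∀ (A : TSubset t) k → TraceCount A k → k ≤ m)

-- π(t) = ½ t log₂ t (1 + o(1)): for every rational ε = p/q > 0 there is T
-- such that for all t ≥ T,  (1-ε) ½ t log₂ t ≤ π(t) ≤ (1+ε) ½ t log₂ t.
-- Exponentiating base 2 (monotone), with 2q·π(t) compared to (q±p)·t·log₂ t,
-- this is exactly:  t^((q-p)t) ≤ 2^(2qπ(t)) ≤ t^((q+p)t)  (truncated ∸ makes the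
-- lower bound trivial when ε ≥ 1, as it is for the real inequality).
HalfTLogT-Asymptotic : (ℕ → ℕ) → Set
HalfTLogT-Asymptotic π =
  ∀ (p q : ℕ) → p ≥ 1 → q ≥ 1 →
  Σ[ T ∈ ℕ ] ∀ t → t ≥ T →
    (t ^ ((q ∸ p) * t) ≤ 2 ^ (2 * q * π t)) ×
    (2 ^ (2 * q * π t) ≤ t ^ ((q + p) * t))

-- A trace of φ̂ on A is the intersection of A with an edge of Q. As Q is triangle-free, the
-- traces on A are exactly the cliques of the induced subgraph: ∅ (cut out by an edge avoiding A),
-- the singletons (cut out by edges leaving A through an unused coordinate) and the edges of A.
-- So A has 1 + |A| + e(A) traces, and π(t) = 1 + t + h(t) with h(t) the largest number of edges
-- spanned by t vertices of Q. By Harper's edge-isoperimetric inequality h is given by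
-- h(2m) = 2h(m) + m, h(2m+1) = h(m) + h(m+1) + m, and attained by initial segments of binary
-- order; e(A) ≤ h(|A|) follows by splitting A along a coordinate, since the crossing edges form
-- a matching and h(a) + h(b) + min(a, b) ≤ h(a + b). The recursion gives
-- n(⌊log₂ n⌋ - 1) < 2h(n) ≤ n log₂ n, hence π(t) = ½ t log₂ t (1 + o(1)).

module Submission where

open import Defs
open import Algebra.Properties.CommutativeSemigroup using (interchange)
open import Data.Bool using (Bool; true; false; not; T; _∧_; _∨_; if_then_else_)
import Data.Bool.Properties as Bool
open import Data.Empty using (⊥-elim)
open import Data.Fin using (Fin; zero; suc; toℕ; fromℕ<)
import Data.Fin.Properties as Fin
open import Data.Fin.Subset using (Subset)
open import Data.List using (List; []; _∷_; length; map; _++_; filter; filterᵇ; tabulate)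
import Data.List as List
open import Data.List.Properties using (filter-some; filter-++; length-map; length-++; length-tabulate; tabulate-lookup)
open import Data.List.Membership.Propositional using (_∈_)
open import Data.List.Membership.Propositional.Properties
  using (∈-++⁺ˡ; ∈-++⁺ʳ; ∈-map⁺; ∈-map⁻; ∈-lookup; ∈-filter⁺; ∈-filter⁻)
open import Data.List.Relation.Binary.Disjoint.Propositional using (Disjoint)
open import Data.List.Relation.Binary.Subset.Propositional using (_⊆_)
import Data.List.Relation.Binary.Subset.Propositional.Properties as ⊆
open import Data.List.Relation.Unary.All using (All; []; _∷_)
import Data.List.Relation.Unary.All as All
open import Data.List.Relation.Unary.All.Properties using (all-filter) renaming (map⁺ to All-map⁺)
open import Data.List.Relation.Unary.AllPairs using (AllPairs; []; _∷_)
import Data.List.Relation.Unary.AllPairs as AllPairs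
import Data.List.Relation.Unary.AllPairs.Properties as AllPairsₚ
open import Data.List.Relation.Unary.Any using (Any; here; there; index)
open import Data.List.Relation.Unary.Any.Properties using (lookup-index)
open import Data.List.Relation.Unary.Unique.Propositional using (Unique)
import Data.List.Relation.Unary.Unique.Propositional.Properties as Uniqueₚ
open import Data.Nat hiding (parity)
open import Data.Nat.Induction using (<-rec)
open import Data.Nat.Properties
open import Data.Nat.Tactic.RingSolver using (solve-∀)
open import Data.Product using (Σ-syntax; ∃-syntax; _×_; _,_; proj₁; proj₂)
open import Data.Sum using (_⊎_; inj₁; inj₂)
open import Data.Vec using (Vec; []; _∷_; lookup)
import Data.Vec as Vec
import Data.Vec.Properties as Vec
open import Function using (_∘_; Equivalence; mk⇔)
open import Relation.Binary.PropositionalEquality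
open import Relation.Nullary using (Dec; yes; no; ¬_; does; map′; ¬?; _→-dec_; _×-dec_)
open import Relation.Nullary.Decidable using (T?; ⌊_⌋; toWitness; fromWitness; dec-true; dec-false)

+-interchange : ∀ a b c d → (a + b) + (c + d) ≡ (a + c) + (b + d)
+-interchange = interchange +-commutativeSemigroup

-- Harper's function

data ParityView : ℕ → Set where
  even : ∀ m → ParityView (m + m)
  odd  : ∀ m → ParityView (suc (m + m))

parityView : ∀ n → ParityView n
parityView zero = even 0
parityView (suc n) with parityView n
... | even m = odd m
... | odd m = subst ParityView (cong suc (+-suc m m)) (even (suc m))

m+m≤1+n+n⇒m≤n : ∀ m n → m + m ≤ suc (n + n) → m ≤ n
m+m≤1+n+n⇒m≤n zero n _ = z≤n
m+m≤1+n+n⇒m≤n (suc m) zero (s≤s p) rewrite +-suc m m with () ← p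
m+m≤1+n+n⇒m≤n (suc m) (suc n) (s≤s p) rewrite +-suc m m | +-suc n n =
  s≤s (m+m≤1+n+n⇒m≤n m n (≤-pred p))

1+m+m≤n+n⇒m<n : ∀ m n → suc (m + m) ≤ n + n → m < n
1+m+m≤n+n⇒m<n m (suc n) (s≤s p) rewrite +-suc n n = s≤s (m+m≤1+n+n⇒m≤n m n p)

m+m≤1+n⇒m≤n : ∀ m n → m + m ≤ suc n → m ≤ n
m+m≤1+n⇒m≤n zero n _ = z≤n
m+m≤1+n⇒m≤n (suc m) n (s≤s p) = ≤-trans (m≤n+m (suc m) m) p

m+m≤n⇒1+m≤n : ∀ m n → 1 ≤ m → m + m ≤ n → suc m ≤ n
m+m≤n⇒1+m≤n (suc m) n _ p = ≤-trans (s≤s (m≤n+m (suc m) m)) p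

-- The fuel only makes the halving recursion structural; any fuel ≥ n gives the same value.
harperWithFuel : ℕ → ℕ → ℕ
harperWithFuel zero n = 0
harperWithFuel (suc f) zero = 0
harperWithFuel (suc f) (suc zero) = 0
harperWithFuel (suc f) n@(suc (suc _)) = harperWithFuel f ⌊ n /2⌋ + harperWithFuel f ⌈ n /2⌉ + ⌊ n /2⌋

harperWithFuel-cong : ∀ f g n → n ≤ f → n ≤ g → harperWithFuel f n ≡ harperWithFuel g n
harperWithFuel-cong zero zero zero _ _ = refl
harperWithFuel-cong zero (suc g) zero _ _ = refl
harperWithFuel-cong (suc f) zero zero _ _ = refl
harperWithFuel-cong (suc f) (suc g) zero _ _ = refl
harperWithFuel-cong (suc f) (suc g) (suc zero) _ _ = refl
harperWithFuel-cong (suc f) (suc g) n@(suc (suc k)) (s≤s n≤f) (s≤s n≤g) =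
  cong₂ (λ a b → a + b + ⌊ n /2⌋)
    (harperWithFuel-cong f g ⌊ n /2⌋ (≤-trans ⌊n/2⌋≤ n≤f) (≤-trans ⌊n/2⌋≤ n≤g))
    (harperWithFuel-cong f g ⌈ n /2⌉ (≤-trans ⌈n/2⌉≤ n≤f) (≤-trans ⌈n/2⌉≤ n≤g))
  where
  ⌊n/2⌋≤ : ⌊ n /2⌋ ≤ suc k
  ⌊n/2⌋≤ = s≤s (⌊n/2⌋≤n k)
  ⌈n/2⌉≤ : ⌈ n /2⌉ ≤ suc k
  ⌈n/2⌉≤ = ≤-pred (⌈n/2⌉<n k)

-- harper n is the number of edges of the hypercube induced by the first n vertices in binary order.
harper : ℕ → ℕ
harper n = harperWithFuel n n

harper-unfold : ∀ k → let n = suc (suc k) in harper n ≡ harper ⌊ n /2⌋ + harper ⌈ n /2⌉ + ⌊ n /2⌋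
harper-unfold k = cong₂ (λ a b → a + b + ⌊ suc (suc k) /2⌋)
  (harperWithFuel-cong (suc k) _ _ (s≤s (⌊n/2⌋≤n k)) ≤-refl)
  (harperWithFuel-cong (suc k) _ _ (≤-pred (⌈n/2⌉<n k)) ≤-refl)

harper-even : ∀ m → harper (m + m) ≡ harper m + harper m + m
harper-even zero = refl
harper-even (suc m) = begin
  harper (suc m + suc m)                         ≡⟨ cong (λ n → harper (suc n)) (+-suc m m) ⟩
  harper (suc (suc (m + m)))                     ≡⟨ harper-unfold (m + m) ⟩
  harper ⌊ 2+m+m /2⌋ + harper ⌈ 2+m+m /2⌉ + ⌊ 2+m+m /2⌋
    ≡⟨ cong₂ (λ a b → harper a + harper b + a) (cong suc (sym (n≡⌊n+n/2⌋ m))) (cong suc (sym (n≡⌈n+n/2⌉ m))) ⟩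
  harper (suc m) + harper (suc m) + suc m        ∎
  where
  open ≡-Reasoning
  2+m+m = suc (suc (m + m))

harper-odd : ∀ m → harper (suc (m + m)) ≡ harper m + harper (suc m) + m
harper-odd zero = refl
harper-odd (suc m) = begin
  harper (suc (suc m + suc m))                   ≡⟨ cong (λ n → harper (suc (suc n))) (+-suc m m) ⟩
  harper (suc (suc (suc (m + m))))               ≡⟨ harper-unfold (suc (m + m)) ⟩
  harper ⌊ 3+m+m /2⌋ + harper ⌈ 3+m+m /2⌉ + ⌊ 3+m+m /2⌋
    ≡⟨ cong₂ (λ a b → harper a + harper b + a) (cong suc (sym (n≡⌈n+n/2⌉ m))) (cong (λ n → suc (suc n)) (sym (n≡⌊n+n/2⌋ m))) ⟩
  harper (suc m) + harper (suc (suc m)) + suc m  ∎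
  where
  open ≡-Reasoning
  3+m+m = suc (suc (suc (m + m)))

SuperadditiveBelow : ℕ → Set
SuperadditiveBelow N = ∀ a b → a + b ≤ N → b ≤ a → harper a + harper b + b ≤ harper (a + b)

1≤m+m⇒1≤m : ∀ m → 1 ≤ m + m → 1 ≤ m
1≤m+m⇒1≤m (suc m) _ = s≤s z≤n

module _ {N} (ih : SuperadditiveBelow N) where
  open ≤-Reasoning

  superadditive-even-even : ∀ x y → (x + x) + (y + y) ≤ suc N → y + y ≤ x + x →
    harper (x + x) + harper (y + y) + (y + y) ≤ harper ((x + x) + (y + y))
  superadditive-even-even x y s b≤a = begin
    harper (x + x) + harper (y + y) + (y + y)       ≡⟨ cong₂ (λ p q → p + q + (y + y)) (harper-even x) (harper-even y) ⟩
    (hx + hx + x) + (hy + hy + y) + (y + y)         ≡⟨ regroup hx hy x y ⟩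
    (hx + hy + y) + (hx + hy + y) + (x + y)         ≤⟨ +-monoˡ-≤ (x + y) (+-mono-≤ half half) ⟩
    harper (x + y) + harper (x + y) + (x + y)       ≡⟨ harper-even (x + y) ⟨
    harper ((x + y) + (x + y))                      ≡⟨ cong harper (+-interchange x x y y) ⟨
    harper ((x + x) + (y + y))                      ∎
    where
    hx = harper x
    hy = harper y
    regroup : ∀ hx hy x y → (hx + hx + x) + (hy + hy + y) + (y + y) ≡ (hx + hy + y) + (hx + hy + y) + (x + y)
    regroup = solve-∀
    half : hx + hy + y ≤ harper (x + y)
    half = ih x y (m+m≤1+n⇒m≤n (x + y) N (subst (_≤ suc N) (+-interchange x x y y) s))
                  (m+m≤1+n+n⇒m≤n y x (m≤n⇒m≤1+n b≤a))

  superadditive-odd-even : ∀ x y → suc (x + x) + (y + y) ≤ suc N → y + y ≤ suc (x + x) → 1 ≤ y + y →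
    harper (suc (x + x)) + harper (y + y) + (y + y) ≤ harper (suc (x + x) + (y + y))
  superadditive-odd-even x y s b≤a 1≤b = begin
    harper (suc (x + x)) + harper (y + y) + (y + y) ≡⟨ cong₂ (λ p q → p + q + (y + y)) (harper-odd x) (harper-even y) ⟩
    (hx + hx' + x) + (hy + hy + y) + (y + y)        ≡⟨ regroup hx hx' hy x y ⟩
    (hx + hy + y) + (hx' + hy + y) + (x + y)        ≤⟨ +-monoˡ-≤ (x + y) (+-mono-≤ (ih x y (<⇒≤ size) y≤x) (ih (suc x) y size (m≤n⇒m≤1+n y≤x))) ⟩
    harper (x + y) + harper (suc (x + y)) + (x + y) ≡⟨ harper-odd (x + y) ⟨
    harper (suc ((x + y) + (x + y)))                ≡⟨ cong (harper ∘ suc) (+-interchange x x y y) ⟨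
    harper (suc (x + x) + (y + y))                  ∎
    where
    hx = harper x
    hx' = harper (suc x)
    hy = harper y
    regroup : ∀ hx hx' hy x y → (hx + hx' + x) + (hy + hy + y) + (y + y) ≡ (hx + hy + y) + (hx' + hy + y) + (x + y)
    regroup = solve-∀
    y≤x : y ≤ x
    y≤x = m+m≤1+n+n⇒m≤n y x b≤a
    size : suc (x + y) ≤ N
    size = m+m≤n⇒1+m≤n (x + y) N (≤-trans (1≤m+m⇒1≤m y 1≤b) (m≤n+m y x))
             (≤-pred (subst (_≤ suc N) (cong suc (+-interchange x x y y)) s))

  superadditive-even-odd : ∀ x y → (x + x) + suc (y + y) ≤ suc N → suc (y + y) ≤ x + x →
    harper (x + x) + harper (suc (y + y)) + suc (y + y) ≤ harper ((x + x) + suc (y + y))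
  superadditive-even-odd x y s b≤a = begin
    harper (x + x) + harper (suc (y + y)) + suc (y + y) ≡⟨ cong₂ (λ p q → p + q + suc (y + y)) (harper-even x) (harper-odd y) ⟩
    (hx + hx + x) + (hy + hy' + y) + suc (y + y)        ≡⟨ regroup hx hy hy' x y ⟩
    (hx + hy + y) + (hx + hy' + suc y) + (x + y)        ≤⟨ +-monoˡ-≤ (x + y) (+-mono-≤ (ih x y (≤-trans (+-monoʳ-≤ x (n≤1+n y)) size) (<⇒≤ y<x)) (ih x (suc y) size y<x)) ⟩
    harper (x + y) + harper (x + suc y) + (x + y)       ≡⟨ cong (λ n → harper (x + y) + harper n + (x + y)) (+-suc x y) ⟩
    harper (x + y) + harper (suc (x + y)) + (x + y)     ≡⟨ harper-odd (x + y) ⟨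
    harper (suc ((x + y) + (x + y)))                    ≡⟨ cong harper (shuffle x y) ⟩
    harper ((x + x) + suc (y + y))                      ∎
    where
    hx = harper x
    hy = harper y
    hy' = harper (suc y)
    regroup : ∀ hx hy hy' x y → (hx + hx + x) + (hy + hy' + y) + suc (y + y) ≡ (hx + hy + y) + (hx + hy' + suc y) + (x + y)
    regroup = solve-∀
    shuffle : ∀ x y → suc ((x + y) + (x + y)) ≡ (x + x) + suc (y + y)
    shuffle = solve-∀
    y<x : y < x
    y<x = 1+m+m≤n+n⇒m<n y x b≤a
    size : x + suc y ≤ N
    size = subst (_≤ N) (sym (+-suc x y))
             (m+m≤n⇒1+m≤n (x + y) N (≤-trans (≤-trans (s≤s z≤n) y<x) (m≤m+n x y))
               (≤-pred (subst (_≤ suc N) (sym (shuffle x y)) s)))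

  superadditive-odd-odd : ∀ x y → suc (x + x) + suc (y + y) ≤ suc N → y < x →
    harper (suc (x + x)) + harper (suc (y + y)) + suc (y + y) ≤ harper (suc (x + x) + suc (y + y))
  superadditive-odd-odd x y s y<x = begin
    harper (suc (x + x)) + harper (suc (y + y)) + suc (y + y) ≡⟨ cong₂ (λ p q → p + q + suc (y + y)) (harper-odd x) (harper-odd y) ⟩
    (hx + hx' + x) + (hy + hy' + y) + suc (y + y)        ≡⟨ regroup hx hx' hy hy' x y ⟩
    (hx' + hy + y) + (hx + hy' + y) + suc (x + y)        ≤⟨ +-monoˡ-≤ (suc (x + y)) (+-mono-≤ (ih (suc x) y size (≤-trans (<⇒≤ y<x) (n≤1+n x))) second) ⟩
    harper (suc (x + y)) + harper (suc (x + y)) + suc (x + y) ≡⟨ harper-even (suc (x + y)) ⟨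
    harper (suc (x + y) + suc (x + y))                   ≡⟨ cong harper (shuffle x y) ⟩
    harper (suc (x + x) + suc (y + y))                   ∎
    where
    hx = harper x
    hx' = harper (suc x)
    hy = harper y
    hy' = harper (suc y)
    regroup : ∀ hx hx' hy hy' x y → (hx + hx' + x) + (hy + hy' + y) + suc (y + y) ≡ (hx' + hy + y) + (hx + hy' + y) + suc (x + y)
    regroup = solve-∀
    shuffle : ∀ x y → suc (x + y) + suc (x + y) ≡ suc (x + x) + suc (y + y)
    shuffle = solve-∀
    size : suc (x + y) ≤ N
    size = m+m≤1+n⇒m≤n (suc (x + y)) N (subst (_≤ suc N) (sym (shuffle x y)) s)
    second : hx + hy' + y ≤ harper (suc (x + y))
    second = begin
      hx + hy' + y          ≤⟨ +-monoʳ-≤ (hx + hy') (n≤1+n y) ⟩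
      hx + hy' + suc y      ≤⟨ ih x (suc y) (subst (_≤ N) (sym (+-suc x y)) size) y<x ⟩
      harper (x + suc y)    ≡⟨ cong harper (+-suc x y) ⟩
      harper (suc (x + y))  ∎

superadditive-step : ∀ N → SuperadditiveBelow N → SuperadditiveBelow (suc N)
superadditive-step N ih a zero _ _ = ≤-reflexive (begin
  harper a + 0 + 0  ≡⟨ +-identityʳ _ ⟩
  harper a + 0      ≡⟨ +-identityʳ _ ⟩
  harper a          ≡⟨ cong harper (+-identityʳ a) ⟨
  harper (a + 0)    ∎)
  where open ≡-Reasoning
superadditive-step N ih a b@(suc _) s b≤a = positive a b s b≤a (s≤s z≤n)
  where
  positive : ∀ a b → a + b ≤ suc N → b ≤ a → 1 ≤ b → harper a + harper b + b ≤ harper (a + b)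
  positive a b s b≤a 1≤b with parityView a | parityView b
  ... | even x | even y = superadditive-even-even ih x y s b≤a
  ... | odd x  | even y = superadditive-odd-even ih x y s b≤a 1≤b
  ... | even x | odd y  = superadditive-even-odd ih x y s b≤a
  ... | odd x  | odd y with y ≟ x
  ...   | yes refl = ≤-reflexive (sym (harper-even (suc (y + y))))
  ...   | no y≢x   = superadditive-odd-odd ih x y s (≤∧≢⇒< (m+m≤1+n+n⇒m≤n y x (≤-trans (n≤1+n _) b≤a)) y≢x)

superadditiveBelow : ∀ N → SuperadditiveBelow N
superadditiveBelow zero zero zero _ _ = ≤-refl
superadditiveBelow (suc N) = superadditive-step N (superadditiveBelow N)

harper-superadditive : ∀ a b c → c ≤ a → c ≤ b → harper a + harper b + c ≤ harper (a + b)
harper-superadditive a b c c≤a c≤b with ≤-total b a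
... | inj₁ b≤a = ≤-trans (+-monoʳ-≤ (harper a + harper b) c≤b) (superadditiveBelow (a + b) a b ≤-refl b≤a)
... | inj₂ a≤b = begin
  harper a + harper b + c  ≤⟨ +-monoʳ-≤ (harper a + harper b) c≤a ⟩
  harper a + harper b + a  ≡⟨ cong (_+ a) (+-comm (harper a) (harper b)) ⟩
  harper b + harper a + a  ≤⟨ superadditiveBelow (b + a) b a ≤-refl a≤b ⟩
  harper (b + a)           ≡⟨ cong harper (+-comm b a) ⟩
  harper (a + b)           ∎
  where open ≤-Reasoning

2^[1+j]≡2^j+2^j : ∀ j → 2 ^ suc j ≡ 2 ^ j + 2 ^ j
2^[1+j]≡2^j+2^j j = cong (2 ^ j +_) (+-identityʳ (2 ^ j))

harper-2^j+ : ∀ j r → r ≤ 2 ^ j → harper (2 ^ j + r) ≡ harper (2 ^ j) + harper r + r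
harper-2^j+ zero zero _ = refl
harper-2^j+ zero (suc zero) _ = refl
harper-2^j+ zero (suc (suc r)) (s≤s ())
harper-2^j+ (suc j) r r≤2^[1+j] rewrite 2^[1+j]≡2^j+2^j j with parityView r
... | even s = begin
  harper (P + P + (s + s))                           ≡⟨ cong harper (+-interchange P P s s) ⟩
  harper ((P + s) + (P + s))                         ≡⟨ harper-even (P + s) ⟩
  harper (P + s) + harper (P + s) + (P + s)          ≡⟨ cong (λ z → z + z + (P + s)) (harper-2^j+ j s s≤P) ⟩
  (hP + hs + s) + (hP + hs + s) + (P + s)            ≡⟨ regroup hP hs P s ⟩
  (hP + hP + P) + (hs + hs + s) + (s + s)            ≡⟨ cong₂ (λ a b → a + b + (s + s)) (harper-even P) (harper-even s) ⟨
  harper (P + P) + harper (s + s) + (s + s)          ∎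
  where
  open ≡-Reasoning
  P = 2 ^ j
  hP = harper P
  hs = harper s
  s≤P = m+m≤1+n+n⇒m≤n s P (m≤n⇒m≤1+n r≤2^[1+j])
  regroup : ∀ hP hs P s → (hP + hs + s) + (hP + hs + s) + (P + s) ≡ (hP + hP + P) + (hs + hs + s) + (s + s)
  regroup = solve-∀
... | odd s = begin
  harper (P + P + suc (s + s))                       ≡⟨ cong harper (shuffle P s) ⟩
  harper (suc ((P + s) + (P + s)))                   ≡⟨ harper-odd (P + s) ⟩
  harper (P + s) + harper (suc (P + s)) + (P + s)    ≡⟨ cong₂ (λ a b → a + b + (P + s)) (harper-2^j+ j s (<⇒≤ s<P)) (trans (cong harper (sym (+-suc P s))) (harper-2^j+ j (suc s) s<P)) ⟩
  (hP + hs + s) + (hP + hs′ + suc s) + (P + s)       ≡⟨ regroup hP hs hs′ P s ⟩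
  (hP + hP + P) + (hs + hs′ + s) + suc (s + s)       ≡⟨ cong₂ (λ a b → a + b + suc (s + s)) (harper-even P) (harper-odd s) ⟨
  harper (P + P) + harper (suc (s + s)) + suc (s + s) ∎
  where
  open ≡-Reasoning
  P = 2 ^ j
  hP = harper P
  hs = harper s
  hs′ = harper (suc s)
  s<P = 1+m+m≤n+n⇒m<n s P r≤2^[1+j]
  shuffle : ∀ P s → P + P + suc (s + s) ≡ suc ((P + s) + (P + s))
  shuffle = solve-∀
  regroup : ∀ hP hs hs′ P s → (hP + hs + s) + (hP + hs′ + suc s) + (P + s) ≡ (hP + hP + P) + (hs + hs′ + s) + suc (s + s)
  regroup = solve-∀

-- Growth of harper

^-distribʳ-* : ∀ m n o → (m * n) ^ o ≡ m ^ o * n ^ o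
^-distribʳ-* m n zero = refl
^-distribʳ-* m n (suc o) = begin
  m * n * (m * n) ^ o      ≡⟨ cong (m * n *_) (^-distribʳ-* m n o) ⟩
  m * n * (m ^ o * n ^ o)  ≡⟨ regroup m n (m ^ o) (n ^ o) ⟩
  m * m ^ o * (n * n ^ o)  ∎
  where
  open ≡-Reasoning
  regroup : ∀ m n x y → m * n * (x * y) ≡ m * x * (n * y)
  regroup = solve-∀

[m+m]^[m+m]≡m^m*m^m*4^m : ∀ m → (m + m) ^ (m + m) ≡ m ^ m * m ^ m * 4 ^ m
[m+m]^[m+m]≡m^m*m^m*4^m m = begin
  (m + m) ^ (m + m)           ≡⟨ ^-distribˡ-+-* (m + m) m m ⟩
  (m + m) ^ m * (m + m) ^ m   ≡⟨ ^-distribʳ-* (m + m) (m + m) m ⟨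
  ((m + m) * (m + m)) ^ m     ≡⟨ cong (_^ m) (square m) ⟩
  (m * m * 4) ^ m             ≡⟨ ^-distribʳ-* (m * m) 4 m ⟩
  (m * m) ^ m * 4 ^ m         ≡⟨ cong (_* 4 ^ m) (^-distribʳ-* m m m) ⟩
  m ^ m * m ^ m * 4 ^ m       ∎
  where
  open ≡-Reasoning
  square : ∀ m → (m + m) * (m + m) ≡ m * m * 4
  square = solve-∀

m^m*[1+m]^[1+m]*4^m≤[1+m+m]^[1+m+m] : ∀ m → m ^ m * suc m ^ suc m * 4 ^ m ≤ suc (m + m) ^ suc (m + m)
m^m*[1+m]^[1+m]*4^m≤[1+m+m]^[1+m+m] m = begin
  m ^ m * suc m ^ suc m * 4 ^ m            ≡⟨ regroup (m ^ m) (suc m ^ m) (4 ^ m) (suc m) ⟩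
  suc m * (m ^ m * suc m ^ m * 4 ^ m)      ≡⟨ cong (λ z → suc m * (z * 4 ^ m)) (^-distribʳ-* m (suc m) m) ⟨
  suc m * ((m * suc m) ^ m * 4 ^ m)        ≡⟨ cong (suc m *_) (^-distribʳ-* (m * suc m) 4 m) ⟨
  suc m * (m * suc m * 4) ^ m              ≤⟨ *-mono-≤ (s≤s (m≤m+n m m)) (^-monoˡ-≤ m (amgm m)) ⟩
  suc (m + m) * (suc (m + m) * suc (m + m)) ^ m  ≡⟨ cong (suc (m + m) *_) (^-distribʳ-* (suc (m + m)) (suc (m + m)) m) ⟩
  suc (m + m) * (suc (m + m) ^ m * suc (m + m) ^ m)  ≡⟨ cong (suc (m + m) *_) (^-distribˡ-+-* (suc (m + m)) m m) ⟨
  suc (m + m) ^ suc (m + m)                ∎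
  where
  open ≤-Reasoning
  regroup : ∀ a b c d → a * (d * b) * c ≡ d * (a * b * c)
  regroup = solve-∀
  amgm : ∀ m → m * suc m * 4 ≤ suc (m + m) * suc (m + m)
  amgm m = ≤-trans (m≤m+n _ 1) (≤-reflexive (square m))
    where
    square : ∀ m → m * suc m * 4 + 1 ≡ suc (m + m) * suc (m + m)
    square = solve-∀

4^harper≤n^n : ∀ n → 4 ^ harper n ≤ n ^ n
4^harper≤n^n = <-rec _ step
  where
  open ≤-Reasoning
  4^[x+y+z] : ∀ x y z → 4 ^ (x + y + z) ≡ 4 ^ x * 4 ^ y * 4 ^ z
  4^[x+y+z] x y z = trans (^-distribˡ-+-* 4 (x + y) z) (cong (_* 4 ^ z) (^-distribˡ-+-* 4 x y))
  step : ∀ n → (∀ {k} → k < n → 4 ^ harper k ≤ k ^ k) → 4 ^ harper n ≤ n ^ n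
  step n rec with parityView n
  ... | even zero = ≤-refl
  ... | odd zero = ≤-refl
  ... | even m@(suc _) = begin
    4 ^ harper (m + m)                       ≡⟨ cong (4 ^_) (harper-even m) ⟩
    4 ^ (harper m + harper m + m)            ≡⟨ 4^[x+y+z] (harper m) (harper m) m ⟩
    4 ^ harper m * 4 ^ harper m * 4 ^ m      ≤⟨ *-monoˡ-≤ (4 ^ m) (*-mono-≤ ih ih) ⟩
    m ^ m * m ^ m * 4 ^ m                    ≡⟨ [m+m]^[m+m]≡m^m*m^m*4^m m ⟨
    (m + m) ^ (m + m)                        ∎
    where ih = rec (m<n+m m (s≤s z≤n))
  ... | odd m@(suc _) = begin
    4 ^ harper (suc (m + m))                 ≡⟨ cong (4 ^_) (harper-odd m) ⟩
    4 ^ (harper m + harper (suc m) + m)      ≡⟨ 4^[x+y+z] (harper m) (harper (suc m)) m ⟩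
    4 ^ harper m * 4 ^ harper (suc m) * 4 ^ m  ≤⟨ *-monoˡ-≤ (4 ^ m) (*-mono-≤ (rec (s≤s (m≤m+n m m))) (rec (s≤s (m<m+n m (s≤s z≤n))))) ⟩
    m ^ m * suc m ^ suc m * 4 ^ m            ≤⟨ m^m*[1+m]^[1+m]*4^m≤[1+m+m]^[1+m+m] m ⟩
    suc (m + m) ^ suc (m + m)                ∎

-- The + 1 is what carries the induction through odd n.
n*L+1≤2*harper+n : ∀ L n → 2 ^ L ≤ n → n * L + 1 ≤ 2 * harper n + n
n*L+1≤2*harper+n zero n 1≤n = begin
  n * 0 + 1           ≡⟨ cong (_+ 1) (*-zeroʳ n) ⟩
  1                   ≤⟨ 1≤n ⟩
  n                   ≤⟨ m≤n+m n _ ⟩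
  2 * harper n + n    ∎
  where open ≤-Reasoning
n*L+1≤2*harper+n (suc L) n 2^[1+L]≤n with parityView n
... | even m = begin
  (m + m) * suc L + 1                      ≤⟨ n≤1+n _ ⟩
  suc ((m + m) * suc L + 1)                ≡⟨ split m L ⟩
  (m * L + 1) + (m * L + 1) + (m + m)      ≤⟨ +-monoˡ-≤ (m + m) (+-mono-≤ ih ih) ⟩
  (2 * hm + m) + (2 * hm + m) + (m + m)    ≡⟨ merge m hm ⟩
  2 * (hm + hm + m) + (m + m)              ≡⟨ cong (λ z → 2 * z + (m + m)) (harper-even m) ⟨
  2 * harper (m + m) + (m + m)             ∎
  where
  open ≤-Reasoning
  hm = harper m
  ih = n*L+1≤2*harper+n L m (m+m≤1+n+n⇒m≤n (2 ^ L) m (≤-trans (≤-reflexive (cong (2 ^ L +_) (sym (+-identityʳ (2 ^ L))))) (m≤n⇒m≤1+n 2^[1+L]≤n)))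
  split : ∀ m L → suc ((m + m) * suc L + 1) ≡ (m * L + 1) + (m * L + 1) + (m + m)
  split = solve-∀
  merge : ∀ m hm → (2 * hm + m) + (2 * hm + m) + (m + m) ≡ 2 * (hm + hm + m) + (m + m)
  merge = solve-∀
... | odd m = begin
  suc (m + m) * suc L + 1                           ≡⟨ split m L ⟩
  (m * L + 1) + (suc m * L + 1) + (m + m)           ≤⟨ +-monoˡ-≤ (m + m) (+-mono-≤ ih ih') ⟩
  (2 * hm + m) + (2 * hm' + suc m) + (m + m)        ≡⟨ merge m hm hm' ⟩
  2 * (hm + hm' + m) + suc (m + m)                  ≡⟨ cong (λ z → 2 * z + suc (m + m)) (harper-odd m) ⟨
  2 * harper (suc (m + m)) + suc (m + m)            ∎
  where
  open ≤-Reasoning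
  hm = harper m
  hm' = harper (suc m)
  2^L≤m : 2 ^ L ≤ m
  2^L≤m = m+m≤1+n+n⇒m≤n (2 ^ L) m (≤-trans (≤-reflexive (cong (2 ^ L +_) (sym (+-identityʳ (2 ^ L))))) 2^[1+L]≤n)
  ih = n*L+1≤2*harper+n L m 2^L≤m
  ih' = n*L+1≤2*harper+n L (suc m) (m≤n⇒m≤1+n 2^L≤m)
  split : ∀ m L → suc (m + m) * suc L + 1 ≡ (m * L + 1) + (suc m * L + 1) + (m + m)
  split = solve-∀
  merge : ∀ m hm hm' → (2 * hm + m) + (2 * hm' + suc m) + (m + m) ≡ 2 * (hm + hm' + m) + suc (m + m)
  merge = solve-∀

⌊log₂⌋-exists : ∀ n → 1 ≤ n → ∃[ L ] 2 ^ L ≤ n × n < 2 ^ suc L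
⌊log₂⌋-exists (suc zero) _ = 0 , s≤s z≤n , s≤s (s≤s z≤n)
⌊log₂⌋-exists (suc (suc n)) _ with ⌊log₂⌋-exists (suc n) (s≤s z≤n)
... | L , 2^L≤n , n<2^[1+L] with suc (suc n) <? 2 ^ suc L
...   | yes n+1<2^[1+L] = L , m≤n⇒m≤1+n 2^L≤n , n+1<2^[1+L]
...   | no n+1≮2^[1+L] = suc L , ≮⇒≥ n+1≮2^[1+L] , (begin-strict
  suc (suc n)              ≡⟨ ≤-antisym n<2^[1+L] (≮⇒≥ n+1≮2^[1+L]) ⟩
  2 ^ suc L                <⟨ m<m+n (2 ^ suc L) (m^n>0 2 (suc L)) ⟩
  2 ^ suc L + 2 ^ suc L    ≡⟨ cong (2 ^ suc L +_) (+-identityʳ _) ⟨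
  2 ^ suc (suc L)          ∎)
  where open ≤-Reasoning

maxTraceCount : ℕ → ℕ
maxTraceCount t = suc (t + harper t)

t^t≤2^[2*maxTraceCount] : ∀ t → 1 ≤ t → t ^ t ≤ 2 ^ (2 * maxTraceCount t)
t^t≤2^[2*maxTraceCount] t 1≤t with ⌊log₂⌋-exists t 1≤t
... | L , 2^L≤t , t<2^[1+L] = begin
  t ^ t              ≤⟨ ^-monoˡ-≤ t (<⇒≤ t<2^[1+L]) ⟩
  (2 ^ suc L) ^ t    ≡⟨ ^-*-assoc 2 (suc L) t ⟩
  2 ^ (suc L * t)    ≤⟨ ^-monoʳ-≤ 2 exponent ⟩
  2 ^ (2 * maxTraceCount t) ∎
  where
  open ≤-Reasoning
  exponent : suc L * t ≤ 2 * maxTraceCount t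
  exponent = begin
    suc L * t                   ≡⟨ expand L t ⟩
    t + t * L                   ≤⟨ +-monoʳ-≤ t (≤-trans (m≤m+n (t * L) 1) (n*L+1≤2*harper+n L t 2^L≤t)) ⟩
    t + (2 * harper t + t)      ≤⟨ m≤n+m _ 2 ⟩
    2 + (t + (2 * harper t + t)) ≡⟨ collect t (harper t) ⟩
    2 * maxTraceCount t         ∎
    where
    expand : ∀ L t → suc L * t ≡ t + t * L
    expand = solve-∀
    collect : ∀ t h → 2 + (t + (2 * h + t)) ≡ 2 * suc (t + h)
    collect = solve-∀

maxTraceCount-lower : ∀ p q t → 1 ≤ t → t ^ ((q ∸ p) * t) ≤ 2 ^ (2 * q * maxTraceCount t)
maxTraceCount-lower p q t@(suc _) 1≤t = begin
  t ^ ((q ∸ p) * t)      ≤⟨ ^-monoʳ-≤ t (*-monoˡ-≤ t (m∸n≤m q p)) ⟩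
  t ^ (q * t)            ≡⟨ cong (t ^_) (*-comm q t) ⟩
  t ^ (t * q)            ≡⟨ ^-*-assoc t t q ⟨
  (t ^ t) ^ q            ≤⟨ ^-monoˡ-≤ q (t^t≤2^[2*maxTraceCount] t 1≤t) ⟩
  (2 ^ (2 * π)) ^ q      ≡⟨ ^-*-assoc 2 (2 * π) q ⟩
  2 ^ (2 * π * q)        ≡⟨ cong (2 ^_) (swap q π) ⟩
  2 ^ (2 * q * π)        ∎
  where
  open ≤-Reasoning
  π = maxTraceCount t
  swap : ∀ q π → 2 * π * q ≡ 2 * q * π
  swap = solve-∀

maxTraceCount-upper : ∀ p q t → 1 ≤ p → 2 ^ (4 * q) ≤ t → 2 ^ (2 * q * maxTraceCount t) ≤ t ^ ((q + p) * t)
maxTraceCount-upper p q zero _ T≤0 with () ← ≤-trans (m^n>0 2 (4 * q)) T≤0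
maxTraceCount-upper p q t@(suc t′) p≥1 T≤t = begin
  2 ^ (2 * q * maxTraceCount t)                   ≡⟨ cong (2 ^_) (split q t (harper t)) ⟩
  2 ^ (2 * q * suc t + 2 * harper t * q)          ≡⟨ ^-distribˡ-+-* 2 (2 * q * suc t) (2 * harper t * q) ⟩
  2 ^ (2 * q * suc t) * 2 ^ (2 * harper t * q)    ≡⟨ cong (2 ^ (2 * q * suc t) *_) (^-*-assoc 2 (2 * harper t) q) ⟨
  2 ^ (2 * q * suc t) * (2 ^ (2 * harper t)) ^ q  ≤⟨ *-mono-≤ linear (^-monoˡ-≤ q 2^[2*harper]≤t^t) ⟩
  t ^ (p * t) * (t ^ t) ^ q                       ≡⟨ cong (t ^ (p * t) *_) (^-*-assoc t t q) ⟩
  t ^ (p * t) * t ^ (t * q)                       ≡⟨ ^-distribˡ-+-* t (p * t) (t * q) ⟨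
  t ^ (p * t + t * q)                             ≡⟨ cong (t ^_) (collect p q t) ⟩
  t ^ ((q + p) * t)                               ∎
  where
  open ≤-Reasoning
  split : ∀ q t h → 2 * q * suc (t + h) ≡ 2 * q * suc t + 2 * h * q
  split = solve-∀
  collect : ∀ p q t → p * t + t * q ≡ (q + p) * t
  collect = solve-∀
  2^[2*harper]≤t^t : 2 ^ (2 * harper t) ≤ t ^ t
  2^[2*harper]≤t^t = subst (_≤ t ^ t) (^-*-assoc 2 2 (harper t)) (4^harper≤n^n t)
  linear : 2 ^ (2 * q * suc t) ≤ t ^ (p * t)
  linear = begin
    2 ^ (2 * q * suc t)    ≤⟨ ^-monoʳ-≤ 2 (*-monoʳ-≤ (2 * q) (s≤s (m≤n+m t t′))) ⟩
    2 ^ (2 * q * (t + t))  ≡⟨ cong (2 ^_) (double q t) ⟩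
    2 ^ (4 * q * t)        ≡⟨ ^-*-assoc 2 (4 * q) t ⟨
    (2 ^ (4 * q)) ^ t      ≤⟨ ^-monoˡ-≤ t T≤t ⟩
    t ^ t                  ≤⟨ ^-monoʳ-≤ t (≤-trans (≤-reflexive (sym (*-identityˡ t))) (*-monoˡ-≤ t p≥1)) ⟩
    t ^ (p * t)            ∎
    where
    double : ∀ q t → 2 * q * (t + t) ≡ 4 * q * t
    double = solve-∀

maxTraceCount-asymptotic : HalfTLogT-Asymptotic maxTraceCount
maxTraceCount-asymptotic p q p≥1 _ = 2 ^ (4 * q) , λ t T≤t →
  maxTraceCount-lower p q t (≤-trans (m^n>0 2 (4 * q)) T≤t) , maxTraceCount-upper p q t p≥1 T≤t

-- The hypercube graph Q

module _ {P : ℕ → Set} (P? : ∀ i → Dec (P i)) {N : ℕ} (beyond : ∀ i → N ≤ i → P i) where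

  private
    below⇒all : (∀ (i : Fin N) → P (toℕ i)) → ∀ i → P i
    below⇒all below i with i <? N
    ... | yes i<N = subst P (Fin.toℕ-fromℕ< i<N) (below (fromℕ< i<N))
    ... | no i≮N = beyond i (≮⇒≥ i≮N)

  all-beyond? : Dec (∀ i → P i)
  all-beyond? = map′ below⇒all (λ all i → all (toℕ i)) (Fin.all? (P? ∘ toℕ))

  counterexample-beyond : ¬ (∀ i → P i) → ∃[ i ] ¬ P i
  counterexample-beyond ¬all with Fin.¬∀⟶∃¬ N (P ∘ toℕ) (P? ∘ toℕ) (¬all ∘ below⇒all)
  ... | i , ¬Pi = toℕ i , ¬Pi

supportBound : Vertex → Vertex → ℕ
supportBound v w = bound v ⊔ bound w

agree-beyond : ∀ v w i → supportBound v w ≤ i → seq v i ≡ seq w i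
agree-beyond v w i b = trans (finite v i (≤-trans (m≤m⊔n (bound v) (bound w)) b))
                         (sym (finite w i (≤-trans (m≤n⊔m (bound v) (bound w)) b)))

_≈?_ : ∀ v w → Dec (v ≈ w)
v ≈? w = all-beyond? (λ i → seq v i Bool.≟ seq w i) (agree-beyond v w)

≉⇒differ : ∀ v w → ¬ v ≈ w → ∃[ c ] seq v c ≢ seq w c
≉⇒differ v w = counterexample-beyond (λ i → seq v i Bool.≟ seq w i) (agree-beyond v w)

≈-sym : ∀ {v w} → v ≈ w → w ≈ v
≈-sym v≈w i = sym (v≈w i)

≈-trans : ∀ {u v w} → u ≈ v → v ≈ w → u ≈ w
≈-trans u≈v v≈w i = trans (u≈v i) (v≈w i)

E⇒agree-off : ∀ {v w} c → E v w → seq v c ≢ seq w c → ∀ j → j ≢ c → seq v j ≡ seq w j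
E⇒agree-off c (i , _ , agree) differ j j≢c with j ≟ i
... | no j≢i = agree j j≢i
... | yes refl with c ≟ j
...   | yes refl = ⊥-elim (j≢c refl)
...   | no c≢j = ⊥-elim (differ (agree c c≢j))

E? : ∀ v w → Dec (E v w)
E? v w with v ≈? w
... | yes v≈w = no λ (i , differ , _) → differ (v≈w i)
... | no v≉w with ≉⇒differ v w v≉w
...   | c , differ = map′ (λ agree → c , differ , agree) (λ e → E⇒agree-off {v} {w} c e differ)
          (all-beyond? (λ j → ¬? (j ≟ c) →-dec (seq v j Bool.≟ seq w j)) (λ j b _ → agree-beyond v w j b))

E-sym : ∀ {v w} → E v w → E w v
E-sym (i , differ , agree) = i , differ ∘ sym , λ j j≢i → sym (agree j j≢i)

E-resp-≈ : ∀ {v v′ w w′} → v ≈ v′ → w ≈ w′ → E v w → E v′ w′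
E-resp-≈ v≈v′ w≈w′ (i , differ , agree) =
  i , (λ e → differ (trans (v≈v′ i) (trans e (sym (w≈w′ i))))) ,
  λ j j≢i → trans (sym (v≈v′ j)) (trans (agree j j≢i) (w≈w′ j))

-- A closed walk flips every coordinate an even number of times, but a triangle makes three flips.
E-triangle-free : ∀ {x y z} → E x y → E y z → ¬ E x z
E-triangle-free {x} {y} {z} (i , dxy , axy) (j , dyz , ayz) (k , dxz , axz) with i ≟ j
... | yes refl = dxz (x≈z k)
  where
  x≈z : x ≈ z
  x≈z m with m ≟ i
  ... | yes refl = trans (Bool.¬-not dxy) (sym (Bool.¬-not (dyz ∘ sym)))
  ... | no m≢i = trans (axy m m≢i) (ayz m m≢i)
... | no i≢j = i≢j (trans (differ⇒k i dxz-i) (sym (differ⇒k j dxz-j)))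
  where
  differ⇒k : ∀ m → seq x m ≢ seq z m → m ≡ k
  differ⇒k m d with m ≟ k
  ... | yes m≡k = m≡k
  ... | no m≢k = ⊥-elim (d (axz m m≢k))
  dxz-i : seq x i ≢ seq z i
  dxz-i e = dxy (trans e (sym (ayz i i≢j)))
  dxz-j : seq x j ≢ seq z j
  dxz-j e = dyz (trans (sym (axy j (i≢j ∘ sym))) e)

neighbour-across-unique : ∀ {u v w} c → E u v → E u w → seq u c ≢ seq v c → seq v c ≡ seq w c → v ≈ w
neighbour-across-unique {u} {v} {w} c euv euw d vw j with j ≟ c
... | yes refl = vw
... | no j≢c = trans (sym (E⇒agree-off {u} {v} c euv d j j≢c)) (E⇒agree-off {u} {w} c euw (λ e → d (trans e (sym vw))) j j≢c)

-- Counting edges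

adjacency : Vertex → Vertex → ℕ
adjacency x y = if ⌊ E? x y ⌋ then 1 else 0

degreeIn : Vertex → List Vertex → ℕ
degreeIn x [] = 0
degreeIn x (y ∷ ys) = adjacency x y + degreeIn x ys

edgeCount : List Vertex → ℕ
edgeCount [] = 0
edgeCount (x ∷ xs) = degreeIn x xs + edgeCount xs

crossEdges : List Vertex → List Vertex → ℕ
crossEdges [] vs = 0
crossEdges (u ∷ us) vs = degreeIn u vs + crossEdges us vs

Distinct : List Vertex → Set
Distinct = AllPairs (λ v w → ¬ v ≈ w)

adjacency-cong : ∀ x y u v → (E x y → E u v) → (E u v → E x y) → adjacency x y ≡ adjacency u v
adjacency-cong x y u v to from with E? x y | E? u v
... | yes _ | yes _ = refl
... | no _  | no _  = refl
... | yes e | no ¬e = ⊥-elim (¬e (to e))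
... | no ¬e | yes e = ⊥-elim (¬e (from e))

adjacency≡1 : ∀ x y → E x y → adjacency x y ≡ 1
adjacency≡1 x y e with E? x y
... | yes _ = refl
... | no ¬e = ⊥-elim (¬e e)

adjacency≡0 : ∀ x y → ¬ E x y → adjacency x y ≡ 0
adjacency≡0 x y ¬e with E? x y
... | yes e = ⊥-elim (¬e e)
... | no _ = refl

adjacency-sym : ∀ x y → adjacency x y ≡ adjacency y x
adjacency-sym x y = adjacency-cong x y y x (E-sym {x} {y}) (E-sym {y} {x})

crossEdges-∷ʳ : ∀ us x vs → crossEdges us (x ∷ vs) ≡ degreeIn x us + crossEdges us vs
crossEdges-∷ʳ [] x vs = refl
crossEdges-∷ʳ (u ∷ us) x vs rewrite crossEdges-∷ʳ us x vs | adjacency-sym u x =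
  regroup (adjacency x u) (degreeIn u vs) (degreeIn x us) (crossEdges us vs)
  where
  regroup : ∀ a b c d → a + b + (c + d) ≡ a + c + (b + d)
  regroup = solve-∀

crossEdges-sym : ∀ us vs → crossEdges us vs ≡ crossEdges vs us
crossEdges-sym [] [] = refl
crossEdges-sym [] (v ∷ vs) = crossEdges-sym [] vs
crossEdges-sym (u ∷ us) vs rewrite crossEdges-sym us vs = sym (crossEdges-∷ʳ vs u us)

degreeIn-++ : ∀ x xs ys → degreeIn x (xs ++ ys) ≡ degreeIn x xs + degreeIn x ys
degreeIn-++ x [] ys = refl
degreeIn-++ x (z ∷ xs) ys rewrite degreeIn-++ x xs ys = sym (+-assoc (adjacency x z) (degreeIn x xs) (degreeIn x ys))

edgeCount-++ : ∀ xs ys → edgeCount (xs ++ ys) ≡ edgeCount xs + edgeCount ys + crossEdges xs ys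
edgeCount-++ [] ys = sym (+-identityʳ (edgeCount ys))
edgeCount-++ (x ∷ xs) ys rewrite edgeCount-++ xs ys | degreeIn-++ x xs ys =
  regroup (degreeIn x xs) (degreeIn x ys) (edgeCount xs) (edgeCount ys) (crossEdges xs ys)
  where
  regroup : ∀ a b c d e → a + b + (c + d + e) ≡ a + c + d + (b + e)
  regroup = solve-∀

seq-at? : ∀ c b (v : Vertex) → Dec (seq v c ≡ b)
seq-at? c b v = seq v c Bool.≟ b

side : ℕ → Bool → List Vertex → List Vertex
side c b = filter (seq-at? c b)

length-sides : ∀ c xs → length (side c true xs) + length (side c false xs) ≡ length xs
length-sides c [] = refl
length-sides c (x ∷ xs) with seq x c
... | true = cong suc (length-sides c xs)
... | false = trans (+-suc _ _) (cong suc (length-sides c xs))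

degreeIn-sides : ∀ c x xs → degreeIn x xs ≡ degreeIn x (side c true xs) + degreeIn x (side c false xs)
degreeIn-sides c x [] = refl
degreeIn-sides c x (y ∷ xs) with seq y c
... | true = trans (cong (adjacency x y +_) (degreeIn-sides c x xs)) (sym (+-assoc (adjacency x y) (degreeIn x (side c true xs)) (degreeIn x (side c false xs))))
... | false = trans (cong (adjacency x y +_) (degreeIn-sides c x xs)) (+-left-comm (adjacency x y) (degreeIn x (side c true xs)) (degreeIn x (side c false xs)))
  where
  +-left-comm : ∀ a b d → a + (b + d) ≡ b + (a + d)
  +-left-comm = solve-∀

edgeCount-sides : ∀ c xs → let S₁ = side c true xs; S₀ = side c false xs in
  edgeCount xs ≡ edgeCount S₁ + edgeCount S₀ + crossEdges S₁ S₀
edgeCount-sides c [] = refl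
edgeCount-sides c (x ∷ xs) with seq x c
... | true rewrite degreeIn-sides c x xs | edgeCount-sides c xs =
  regroup (degreeIn x (side c true xs)) (degreeIn x (side c false xs)) (edgeCount (side c true xs))
          (edgeCount (side c false xs)) (crossEdges (side c true xs) (side c false xs))
  where
  regroup : ∀ a b p q r → a + b + (p + q + r) ≡ a + p + q + (b + r)
  regroup = solve-∀
... | false rewrite degreeIn-sides c x xs | edgeCount-sides c xs | crossEdges-∷ʳ (side c true xs) x (side c false xs) =
  regroup (degreeIn x (side c true xs)) (degreeIn x (side c false xs)) (edgeCount (side c true xs))
          (edgeCount (side c false xs)) (crossEdges (side c true xs) (side c false xs))
  where
  regroup : ∀ a b p q r → a + b + (p + q + r) ≡ p + (b + q) + (a + r)
  regroup = solve-∀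

degreeIn-≡0 : ∀ {u v} c vs → E u v → seq u c ≢ seq v c →
  All (λ w → seq w c ≡ seq v c) vs → All (λ w → ¬ v ≈ w) vs → degreeIn u vs ≡ 0
degreeIn-≡0 c [] _ _ _ _ = refl
degreeIn-≡0 {u} {v} c (w ∷ vs) euv d (wc ∷ wcs) (v≉w ∷ v≉ws) =
  cong₂ _+_ (adjacency≡0 u w λ euw → v≉w (neighbour-across-unique {u} {v} {w} c euv euw d (sym wc)))
            (degreeIn-≡0 {u} {v} c vs euv d wcs v≉ws)

degreeIn-across≤1 : ∀ u b c vs → seq u c ≡ b → All (λ v → seq v c ≡ not b) vs → Distinct vs → degreeIn u vs ≤ 1
degreeIn-across≤1 u b c [] _ _ _ = z≤n
degreeIn-across≤1 u b c (v ∷ vs) ub (vb ∷ vbs) (v≉vs ∷ distinct) with E? u v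
... | yes euv = ≤-reflexive (cong suc (degreeIn-≡0 {u} {v} c vs euv (λ e → Bool.not-¬ ub (trans e vb)) (All.map (λ wb → trans wb (sym vb)) vbs) v≉vs))
... | no _ = degreeIn-across≤1 u b c vs ub vbs distinct

crossEdges-across≤ : ∀ us vs b c → All (λ u → seq u c ≡ b) us → All (λ v → seq v c ≡ not b) vs → Distinct vs →
  crossEdges us vs ≤ length us
crossEdges-across≤ [] vs b c _ _ _ = z≤n
crossEdges-across≤ (u ∷ us) vs b c (ub ∷ ubs) vbs distinct =
  +-mono-≤ (degreeIn-across≤1 u b c vs ub vbs distinct) (crossEdges-across≤ us vs b c ubs vbs distinct)

sides-nonempty : ∀ c x y zs → seq x c ≢ seq y c →
  0 < length (side c true (x ∷ y ∷ zs)) × 0 < length (side c false (x ∷ y ∷ zs))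
sides-nonempty c x y zs differ = filter-some (seq-at? c true) (meets true) , filter-some (seq-at? c false) (meets false)
  where
  meets : ∀ b → Any (λ v → seq v c ≡ b) (x ∷ y ∷ zs)
  meets b with seq x c Bool.≟ b
  ... | yes x≡b = here x≡b
  ... | no x≢b = there (here (begin
    seq y c              ≡⟨ Bool.¬-not (differ ∘ sym) ⟩
    not (seq x c)        ≡⟨ cong not (Bool.¬-not x≢b) ⟩
    not (not b)          ≡⟨ Bool.not-involutive b ⟩
    b                    ∎))
    where open ≡-Reasoning

edgeCount≤harper : ∀ xs → Distinct xs → edgeCount xs ≤ harper (length xs)
edgeCount≤harper xs = bounded (length xs) xs ≤-refl
  where
  bounded : ∀ N xs → length xs ≤ N → Distinct xs → edgeCount xs ≤ harper (length xs)
  bounded N [] _ _ = z≤n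
  bounded N (x ∷ []) _ _ = z≤n
  bounded (suc N) xs@(x ∷ y ∷ zs) len distinct@((x≉y ∷ _) ∷ _) with ≉⇒differ x y x≉y
  ... | c , differ = begin
    edgeCount xs                                                ≡⟨ edgeCount-sides c xs ⟩
    edgeCount S₁ + edgeCount S₀ + crossEdges S₁ S₀              ≤⟨ +-monoˡ-≤ (crossEdges S₁ S₀) (+-mono-≤ ih₁ ih₀) ⟩
    harper (length S₁) + harper (length S₀) + crossEdges S₁ S₀  ≤⟨ harper-superadditive (length S₁) (length S₀) (crossEdges S₁ S₀) cross≤₁ cross≤₀ ⟩
    harper (length S₁ + length S₀)                              ≡⟨ cong harper (length-sides c xs) ⟩
    harper (length xs)                                          ∎
    where
    open ≤-Reasoning
    S₁ = side c true xs
    S₀ = side c false xs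
    distinct₁ = AllPairsₚ.filter⁺ (seq-at? c true) distinct
    distinct₀ = AllPairsₚ.filter⁺ (seq-at? c false) distinct
    sizes : length S₁ + length S₀ ≤ suc N
    sizes = subst (_≤ suc N) (sym (length-sides c xs)) len
    shrink : ∀ {m n} → 0 < n → m + n ≤ suc N → m ≤ N
    shrink {m} {n} 0<n m+n≤ = ≤-pred (≤-trans (subst (_≤ m + n) (+-comm m 1) (+-monoʳ-≤ m 0<n)) m+n≤)
    ih₁ : edgeCount S₁ ≤ harper (length S₁)
    ih₁ = bounded N S₁ (shrink (proj₂ (sides-nonempty c x y zs differ)) sizes) distinct₁
    ih₀ : edgeCount S₀ ≤ harper (length S₀)
    ih₀ = bounded N S₀ (shrink (proj₁ (sides-nonempty c x y zs differ)) (subst (_≤ suc N) (+-comm (length S₁) _) sizes)) distinct₀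
    cross≤₁ : crossEdges S₁ S₀ ≤ length S₁
    cross≤₁ = crossEdges-across≤ S₁ S₀ true c (all-filter (seq-at? c true) xs) (all-filter (seq-at? c false) xs) distinct₀
    cross≤₀ : crossEdges S₁ S₀ ≤ length S₀
    cross≤₀ = subst (_≤ length S₀) (crossEdges-sym S₀ S₁)
      (crossEdges-across≤ S₀ S₁ false c (all-filter (seq-at? c false) xs) (all-filter (seq-at? c true) xs) distinct₁)

-- Initial segments of binary order

origin : Vertex
origin = mkVertex (λ _ → false) 0 (λ _ _ → refl)

prepend : Bool → Vertex → Vertex
prepend b v = mkVertex s (suc (bound v)) s-finite
  where
  s : ℕ → Bool
  s zero = b
  s (suc i) = seq v i
  s-finite : ∀ m → m ≥ suc (bound v) → s m ≡ false
  s-finite (suc m) (s≤s m≥bound) = finite v m m≥bound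

prepend-≈⁻ : ∀ b u v → prepend b u ≈ prepend b v → u ≈ v
prepend-≈⁻ b u v e j = e (suc j)

prepend-E⁺ : ∀ b u v → E u v → E (prepend b u) (prepend b v)
prepend-E⁺ b u v (i , differ , agree) = suc i , differ , λ where
  zero _ → refl
  (suc j) j≢i → agree j (j≢i ∘ cong suc)

prepend-E⁻ : ∀ b u v → E (prepend b u) (prepend b v) → E u v
prepend-E⁻ b u v (zero , differ , _) = ⊥-elim (differ refl)
prepend-E⁻ b u v (suc i , differ , agree) = i , differ , λ j j≢i → agree (suc j) (j≢i ∘ suc-injective)

prepend-E-across⁺ : ∀ u v → u ≈ v → E (prepend true u) (prepend false v)
prepend-E-across⁺ u v u≈v = zero , (λ ()) , λ where
  zero 0≢0 → ⊥-elim (0≢0 refl)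
  (suc j) _ → u≈v j

prepend-E-across⁻ : ∀ u v → E (prepend true u) (prepend false v) → u ≈ v
prepend-E-across⁻ u v e j = E⇒agree-off {prepend true u} {prepend false v} zero e (λ ()) (suc j) (λ ())

degreeIn-prepend : ∀ b u xs → degreeIn (prepend b u) (map (prepend b) xs) ≡ degreeIn u xs
degreeIn-prepend b u [] = refl
degreeIn-prepend b u (x ∷ xs) =
  cong₂ _+_ (adjacency-cong (prepend b u) (prepend b x) u x (prepend-E⁻ b u x) (prepend-E⁺ b u x)) (degreeIn-prepend b u xs)

edgeCount-prepend : ∀ b xs → edgeCount (map (prepend b) xs) ≡ edgeCount xs
edgeCount-prepend b [] = refl
edgeCount-prepend b (x ∷ xs) = cong₂ _+_ (degreeIn-prepend b x xs) (edgeCount-prepend b xs)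

degreeIn-prepend-across : ∀ y xs → y ∈ xs → Distinct xs → degreeIn (prepend true y) (map (prepend false) xs) ≡ 1
degreeIn-prepend-across y (x ∷ xs) (here refl) (y≉xs ∷ _) =
  cong₂ _+_ (adjacency≡1 (prepend true y) (prepend false y) (prepend-E-across⁺ y y (λ _ → refl))) (none xs y≉xs)
  where
  none : ∀ xs → All (λ z → ¬ y ≈ z) xs → degreeIn (prepend true y) (map (prepend false) xs) ≡ 0
  none [] [] = refl
  none (z ∷ xs) (y≉z ∷ y≉xs) = cong₂ _+_ (adjacency≡0 (prepend true y) (prepend false z) (y≉z ∘ prepend-E-across⁻ y z)) (none xs y≉xs)
degreeIn-prepend-across y (x ∷ xs) (there y∈xs) (x≉xs ∷ distinct) =
  cong₂ _+_ (adjacency≡0 (prepend true y) (prepend false x) λ e → All.lookup x≉xs y∈xs (≈-sym {y} {x} (prepend-E-across⁻ y x e)))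
            (degreeIn-prepend-across y xs y∈xs distinct)

crossEdges-prepend-across : ∀ xs ys → ys ⊆ xs → Distinct xs →
  crossEdges (map (prepend true) ys) (map (prepend false) xs) ≡ length ys
crossEdges-prepend-across xs [] _ _ = refl
crossEdges-prepend-across xs (y ∷ ys) ys⊆xs distinct =
  cong₂ _+_ (degreeIn-prepend-across y xs (ys⊆xs (here refl)) distinct)
            (crossEdges-prepend-across xs ys (ys⊆xs ∘ there) distinct)

Distinct-prepend : ∀ b xs → Distinct xs → Distinct (map (prepend b) xs)
Distinct-prepend b xs = AllPairsₚ.map⁺ ∘ AllPairs.map (λ {u} {v} u≉v → u≉v ∘ prepend-≈⁻ b u v)

Distinct-prepend-++ : ∀ xs ys → Distinct xs → Distinct ys → Distinct (map (prepend false) xs ++ map (prepend true) ys)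
Distinct-prepend-++ xs ys dxs dys = AllPairsₚ.++⁺ (Distinct-prepend false xs dxs) (Distinct-prepend true ys dys)
  (All-map⁺ (All.tabulate λ _ → All-map⁺ (All.tabulate λ _ e → false≢true (e zero))))
  where
  false≢true : false ≢ true
  false≢true ()

-- The first n vertices of the j-cube in binary order (n ≤ 2 ^ j): the extremal sets of Harper's inequality.
segment : ℕ → ℕ → List Vertex
segment zero zero = []
segment zero (suc _) = origin ∷ []
segment (suc j) n with n ≤? 2 ^ j
... | yes _ = map (prepend false) (segment j n)
... | no _ = map (prepend false) (segment j (2 ^ j)) ++ map (prepend true) (segment j (n ∸ 2 ^ j))

n∸2^j≤2^j : ∀ j n → n ≤ 2 ^ suc j → n ∸ 2 ^ j ≤ 2 ^ j
n∸2^j≤2^j j n n≤ = ≤-trans (∸-monoˡ-≤ (2 ^ j) (subst (n ≤_) (2^[1+j]≡2^j+2^j j) n≤)) (≤-reflexive (m+n∸m≡n (2 ^ j) (2 ^ j)))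

length-segment : ∀ j n → n ≤ 2 ^ j → length (segment j n) ≡ n
length-segment zero zero _ = refl
length-segment zero (suc zero) _ = refl
length-segment zero (suc (suc n)) (s≤s ())
length-segment (suc j) n n≤ with n ≤? 2 ^ j
... | yes n≤half = trans (length-map (prepend false) (segment j n)) (length-segment j n n≤half)
... | no n≰half = begin
  length (map (prepend false) (segment j P) ++ map (prepend true) (segment j r))  ≡⟨ length-++ (map (prepend false) (segment j P)) ⟩
  length (map (prepend false) (segment j P)) + length (map (prepend true) (segment j r))
    ≡⟨ cong₂ _+_ (length-map (prepend false) (segment j P)) (length-map (prepend true) (segment j r)) ⟩
  length (segment j P) + length (segment j r)  ≡⟨ cong₂ _+_ (length-segment j P ≤-refl) (length-segment j r (n∸2^j≤2^j j n n≤)) ⟩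
  P + r                                        ≡⟨ m+[n∸m]≡n (<⇒≤ (≰⇒> n≰half)) ⟩
  n                                            ∎
  where
  open ≡-Reasoning
  P = 2 ^ j
  r = n ∸ 2 ^ j

segment-distinct : ∀ j n → Distinct (segment j n)
segment-distinct zero zero = []
segment-distinct zero (suc n) = [] ∷ []
segment-distinct (suc j) n with n ≤? 2 ^ j
... | yes _ = Distinct-prepend false (segment j n) (segment-distinct j n)
... | no _ = Distinct-prepend-++ (segment j (2 ^ j)) (segment j (n ∸ 2 ^ j)) (segment-distinct j (2 ^ j)) (segment-distinct j (n ∸ 2 ^ j))

segment-mono : ∀ j k n → k ≤ n → n ≤ 2 ^ j → segment j k ⊆ segment j n
segment-mono zero zero n _ _ ()
segment-mono zero (suc k) (suc n) _ _ k∈ = k∈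
segment-mono (suc j) k n k≤n n≤ with k ≤? 2 ^ j | n ≤? 2 ^ j
... | yes _ | yes n≤half = ⊆.map⁺ (prepend false) (segment-mono j k n k≤n n≤half)
... | yes k≤half | no _ = ⊆.xs⊆xs++ys _ _ ∘ ⊆.map⁺ (prepend false) (segment-mono j k (2 ^ j) k≤half ≤-refl)
... | no k≰half | yes n≤half = ⊥-elim (k≰half (≤-trans k≤n n≤half))
... | no _ | no _ = ⊆.++⁺ (λ x∈ → x∈) (⊆.map⁺ (prepend true)
        (segment-mono j (k ∸ 2 ^ j) (n ∸ 2 ^ j) (∸-monoˡ-≤ (2 ^ j) k≤n) (n∸2^j≤2^j j n n≤)))

edgeCount-segment : ∀ j n → n ≤ 2 ^ j → edgeCount (segment j n) ≡ harper n
edgeCount-segment zero zero _ = refl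
edgeCount-segment zero (suc zero) _ = refl
edgeCount-segment zero (suc (suc n)) (s≤s ())
edgeCount-segment (suc j) n n≤ with n ≤? 2 ^ j
... | yes n≤half = trans (edgeCount-prepend false (segment j n)) (edgeCount-segment j n n≤half)
... | no n≰half = begin
  edgeCount (lower ++ upper)                            ≡⟨ edgeCount-++ lower upper ⟩
  edgeCount lower + edgeCount upper + crossEdges lower upper
    ≡⟨ cong₂ (λ a b → a + b + crossEdges lower upper) (edgeCount-prepend false (segment j P)) (edgeCount-prepend true (segment j r)) ⟩
  edgeCount (segment j P) + edgeCount (segment j r) + crossEdges lower upper
    ≡⟨ cong₂ (λ a b → a + b + crossEdges lower upper) (edgeCount-segment j P ≤-refl) (edgeCount-segment j r r≤P) ⟩
  harper P + harper r + crossEdges lower upper          ≡⟨ cong (harper P + harper r +_) cross ⟩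
  harper P + harper r + r                               ≡⟨ harper-2^j+ j r r≤P ⟨
  harper (P + r)                                        ≡⟨ cong harper (m+[n∸m]≡n (<⇒≤ (≰⇒> n≰half))) ⟩
  harper n                                              ∎
  where
  open ≡-Reasoning
  P = 2 ^ j
  r = n ∸ 2 ^ j
  r≤P = n∸2^j≤2^j j n n≤
  lower = map (prepend false) (segment j P)
  upper = map (prepend true) (segment j r)
  cross : crossEdges lower upper ≡ r
  cross = begin
    crossEdges lower upper  ≡⟨ crossEdges-sym lower upper ⟩
    crossEdges upper lower  ≡⟨ crossEdges-prepend-across (segment j P) (segment j r) (segment-mono j r P r≤P ≤-refl) (segment-distinct j P) ⟩
    length (segment j r)    ≡⟨ length-segment j r r≤P ⟩
    r                       ∎

n≤2^n : ∀ n → n ≤ 2 ^ n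
n≤2^n zero = z≤n
n≤2^n (suc n) = subst (suc n ≤_) (sym (2^[1+j]≡2^j+2^j n)) (+-mono-≤ (m^n>0 2 n) (n≤2^n n))

-- Traces are cliques

countᵇ : ∀ {A : Set} → (A → Bool) → List A → ℕ
countᵇ p = length ∘ filterᵇ p

countᵇ-++ : ∀ {A : Set} (p : A → Bool) xs ys → countᵇ p (xs ++ ys) ≡ countᵇ p xs + countᵇ p ys
countᵇ-++ p xs ys = trans (cong length (filter-++ _ xs ys)) (length-++ (filterᵇ p xs))

countᵇ-map : ∀ {A B : Set} (p : B → Bool) (f : A → B) xs → countᵇ p (map f xs) ≡ countᵇ (p ∘ f) xs
countᵇ-map p f [] = refl
countᵇ-map p f (x ∷ xs) with p (f x)
... | true = cong suc (countᵇ-map p f xs)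
... | false = countᵇ-map p f xs

countᵇ-false : ∀ {A : Set} (p : A → Bool) xs → (∀ x → p x ≡ false) → countᵇ p xs ≡ 0
countᵇ-false p [] _ = refl
countᵇ-false p (x ∷ xs) never rewrite never x = countᵇ-false p xs never

AllPairs¬⇒lookup-injective : ∀ {X : Set} {S : X → X → Set} → (∀ {x y} → S x y → S y x) →
  ∀ xs → AllPairs (λ x y → ¬ S x y) xs → ∀ i j → S (List.lookup xs i) (List.lookup xs j) → i ≡ j
AllPairs¬⇒lookup-injective S-sym (x ∷ xs) _ zero zero _ = refl
AllPairs¬⇒lookup-injective S-sym (x ∷ xs) (x≁xs ∷ _) zero (suc j) s = ⊥-elim (All.lookup x≁xs (∈-lookup j) s)
AllPairs¬⇒lookup-injective S-sym (x ∷ xs) (x≁xs ∷ _) (suc i) zero s = ⊥-elim (All.lookup x≁xs (∈-lookup i) (S-sym s))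
AllPairs¬⇒lookup-injective S-sym (x ∷ xs) (_ ∷ pairs) (suc i) (suc j) s = cong suc (AllPairs¬⇒lookup-injective S-sym xs pairs i j s)

subsets : ∀ n → List (Vec Bool n)
subsets zero = [] ∷ []
subsets (suc n) = map (false ∷_) (subsets n) ++ map (true ∷_) (subsets n)

countᵇ-subsets : ∀ {n} (p : Vec Bool (suc n) → Bool) →
  countᵇ p (subsets (suc n)) ≡ countᵇ (p ∘ (false ∷_)) (subsets n) + countᵇ (p ∘ (true ∷_)) (subsets n)
countᵇ-subsets {n} p = trans (countᵇ-++ p (map (false ∷_) (subsets n)) (map (true ∷_) (subsets n)))
  (cong₂ _+_ (countᵇ-map p (false ∷_) (subsets n)) (countᵇ-map p (true ∷_) (subsets n)))

∈-subsets : ∀ {n} (σ : Vec Bool n) → σ ∈ subsets n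
∈-subsets [] = here refl
∈-subsets {suc n} (false ∷ σ) = ∈-++⁺ˡ (∈-map⁺ (false ∷_) (∈-subsets σ))
∈-subsets {suc n} (true ∷ σ) = ∈-++⁺ʳ (map (false ∷_) (subsets n)) (∈-map⁺ (true ∷_) (∈-subsets σ))

subsets-unique : ∀ n → Unique (subsets n)
subsets-unique zero = [] ∷ []
subsets-unique (suc n) = Uniqueₚ.++⁺ (Uniqueₚ.map⁺ Vec.∷-injectiveʳ (subsets-unique n)) (Uniqueₚ.map⁺ Vec.∷-injectiveʳ (subsets-unique n)) disjoint
  where
  disjoint : Disjoint (map (false ∷_) (subsets n)) (map (true ∷_) (subsets n))
  disjoint (σ∈false , σ∈true) with ∈-map⁻ (false ∷_) σ∈false | ∈-map⁻ (true ∷_) σ∈true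
  ... | _ , _ , refl | _ , _ , ()

adjacentToAll : Vertex → ∀ {n} → (Fin n → Vertex) → Vec Bool n → Bool
adjacentToAll x g [] = true
adjacentToAll x g (false ∷ σ) = adjacentToAll x (g ∘ suc) σ
adjacentToAll x g (true ∷ σ) = ⌊ E? x (g zero) ⌋ ∧ adjacentToAll x (g ∘ suc) σ

isClique : ∀ {n} → (Fin n → Vertex) → Vec Bool n → Bool
isClique f [] = true
isClique f (false ∷ σ) = isClique (f ∘ suc) σ
isClique f (true ∷ σ) = adjacentToAll (f zero) (f ∘ suc) σ ∧ isClique (f ∘ suc) σ

-- In a triangle-free graph only the empty set is a clique inside the common neighbourhood of an edge.
count-common-neighbourhood-cliques : ∀ {n} x y (g : Fin n → Vertex) → E x y →
  countᵇ (λ σ → adjacentToAll x g σ ∧ (adjacentToAll y g σ ∧ isClique g σ)) (subsets n) ≡ 1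
count-common-neighbourhood-cliques {zero} x y g e = refl
count-common-neighbourhood-cliques {suc n} x y g exy =
  trans (countᵇ-subsets (λ σ → adjacentToAll x g σ ∧ (adjacentToAll y g σ ∧ isClique g σ)))
        (cong₂ _+_ (count-common-neighbourhood-cliques x y (g ∘ suc) exy) containing-g₀)
  where
  containing-g₀ : countᵇ (λ σ → (⌊ E? x (g zero) ⌋ ∧ adjacentToAll x (g ∘ suc) σ) ∧
                    ((⌊ E? y (g zero) ⌋ ∧ adjacentToAll y (g ∘ suc) σ) ∧
                     (adjacentToAll (g zero) (g ∘ suc) σ ∧ isClique (g ∘ suc) σ))) (subsets n) ≡ 0
  containing-g₀ with E? x (g zero) | E? y (g zero)
  ... | yes exg | yes eyg = ⊥-elim (E-triangle-free {x} {y} {g zero} exy eyg exg)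
  ... | no _    | _       = countᵇ-false _ (subsets n) (λ _ → refl)
  ... | yes _   | no _    = countᵇ-false _ (subsets n) (λ σ → Bool.∧-zeroʳ (adjacentToAll x (g ∘ suc) σ))

count-neighbourhood-cliques : ∀ {n} x (g : Fin n → Vertex) →
  countᵇ (λ σ → adjacentToAll x g σ ∧ isClique g σ) (subsets n) ≡ suc (degreeIn x (tabulate g))
count-neighbourhood-cliques {zero} x g = refl
count-neighbourhood-cliques {suc n} x g =
  trans (countᵇ-subsets (λ σ → adjacentToAll x g σ ∧ isClique g σ))
    (trans (cong₂ _+_ (count-neighbourhood-cliques x (g ∘ suc)) containing-g₀)
           (cong suc (+-comm (degreeIn x (tabulate (g ∘ suc))) (adjacency x (g zero)))))
  where
  containing-g₀ : countᵇ (λ σ → (⌊ E? x (g zero) ⌋ ∧ adjacentToAll x (g ∘ suc) σ) ∧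
                    (adjacentToAll (g zero) (g ∘ suc) σ ∧ isClique (g ∘ suc) σ)) (subsets n) ≡ adjacency x (g zero)
  containing-g₀ with E? x (g zero)
  ... | yes e = count-common-neighbourhood-cliques x (g zero) (g ∘ suc) e
  ... | no _ = countᵇ-false _ (subsets n) (λ _ → refl)

count-cliques : ∀ {n} (f : Fin n → Vertex) → countᵇ (isClique f) (subsets n) ≡ suc (n + edgeCount (tabulate f))
count-cliques {zero} f = refl
count-cliques {suc n} f =
  trans (countᵇ-subsets (isClique f))
    (trans (cong₂ _+_ (count-cliques (f ∘ suc)) (count-neighbourhood-cliques (f zero) (f ∘ suc)))
           (regroup n (edgeCount (tabulate (f ∘ suc))) (degreeIn (f zero) (tabulate (f ∘ suc)))))
  where
  regroup : ∀ n e d → suc (n + e) + suc d ≡ suc (suc n + (d + e))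
  regroup = solve-∀

IsClique : ∀ {n} → (Fin n → Vertex) → Vec Bool n → Set
IsClique f σ = ∀ k l → lookup σ k ≡ true → lookup σ l ≡ true → k ≢ l → E (f k) (f l)

module _ {x y : Bool} where
  T-∧⁻ : T (x ∧ y) → T x × T y
  T-∧⁻ = Equivalence.to Bool.T-∧

  T-∧⁺ : T x → T y → T (x ∧ y)
  T-∧⁺ tx ty = Equivalence.from Bool.T-∧ (tx , ty)

adjacentToAll-sound : ∀ x {n} (g : Fin n → Vertex) σ → T (adjacentToAll x g σ) → ∀ k → lookup σ k ≡ true → E x (g k)
adjacentToAll-sound x g (false ∷ σ) t (suc k) σk = adjacentToAll-sound x (g ∘ suc) σ t k σk
adjacentToAll-sound x g (true ∷ σ) t zero _ = toWitness {a? = E? x (g zero)} (proj₁ (T-∧⁻ t))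
adjacentToAll-sound x g (true ∷ σ) t (suc k) σk = adjacentToAll-sound x (g ∘ suc) σ (proj₂ (T-∧⁻ {⌊ E? x (g zero) ⌋} t)) k σk

adjacentToAll-complete : ∀ x {n} (g : Fin n → Vertex) σ → (∀ k → lookup σ k ≡ true → E x (g k)) → T (adjacentToAll x g σ)
adjacentToAll-complete x g [] _ = _
adjacentToAll-complete x g (false ∷ σ) adj = adjacentToAll-complete x (g ∘ suc) σ (adj ∘ suc)
adjacentToAll-complete x g (true ∷ σ) adj =
  T-∧⁺ (fromWitness {a? = E? x (g zero)} (adj zero refl)) (adjacentToAll-complete x (g ∘ suc) σ (adj ∘ suc))

isClique-sound : ∀ {n} (f : Fin n → Vertex) σ → T (isClique f σ) → IsClique f σ
isClique-sound f (false ∷ σ) t (suc k) (suc l) σk σl k≢l = isClique-sound (f ∘ suc) σ t k l σk σl (k≢l ∘ cong suc)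
isClique-sound f (true ∷ σ) t zero zero _ _ 0≢0 = ⊥-elim (0≢0 refl)
isClique-sound f (true ∷ σ) t zero (suc l) _ σl _ =
  adjacentToAll-sound (f zero) (f ∘ suc) σ (proj₁ (T-∧⁻ t)) l σl
isClique-sound f (true ∷ σ) t (suc k) zero σk _ _ =
  E-sym {f zero} {f (suc k)} (adjacentToAll-sound (f zero) (f ∘ suc) σ (proj₁ (T-∧⁻ t)) k σk)
isClique-sound f (true ∷ σ) t (suc k) (suc l) σk σl k≢l =
  isClique-sound (f ∘ suc) σ (proj₂ (T-∧⁻ {adjacentToAll (f zero) (f ∘ suc) σ} t)) k l σk σl (k≢l ∘ cong suc)

isClique-complete : ∀ {n} (f : Fin n → Vertex) σ → IsClique f σ → T (isClique f σ)
isClique-complete f [] _ = _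
isClique-complete f (false ∷ σ) clique =
  isClique-complete (f ∘ suc) σ λ k l σk σl k≢l → clique (suc k) (suc l) σk σl (k≢l ∘ Fin.suc-injective)
isClique-complete f (true ∷ σ) clique =
  T-∧⁺ (adjacentToAll-complete (f zero) (f ∘ suc) σ λ k σk → clique zero (suc k) refl σk (λ ()))
       (isClique-complete (f ∘ suc) σ λ k l σk σl k≢l → clique (suc k) (suc l) σk σl (k≢l ∘ Fin.suc-injective))

switchOn : Vertex → ℕ → Vertex
switchOn v B = mkVertex (λ i → seq v i ∨ does (i ≟ B)) (suc B ⊔ bound v) λ m m≥ →
  cong₂ _∨_ (finite v m (≤-trans (m≤n⊔m (suc B) (bound v)) m≥))
            (dec-false (m ≟ B) λ m≡B → <⇒≢ (≤-trans (m≤m⊔n (suc B) (bound v)) m≥) (sym m≡B))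

switchOn-on : ∀ v B → seq (switchOn v B) B ≡ true
switchOn-on v B = trans (cong (seq v B ∨_) (dec-true (B ≟ B) refl)) (Bool.∨-zeroʳ (seq v B))

switchOn-keeps : ∀ v B i → seq v i ≡ true → seq (switchOn v B) i ≡ true
switchOn-keeps v B i vi = cong (_∨ does (i ≟ B)) vi

E-switchOn : ∀ v B → bound v ≤ B → E v (switchOn v B)
E-switchOn v B bound≤B = B , differ , agree
  where
  differ : seq v B ≢ seq (switchOn v B) B
  differ e = Bool.not-¬ (finite v B bound≤B) (trans e (switchOn-on v B))
  agree : ∀ j → j ≢ B → seq v j ≡ seq v j ∨ does (j ≟ B)
  agree j j≢B = trans (sym (Bool.∨-identityʳ (seq v j))) (cong (seq v j ∨_) (sym (dec-false (j ≟ B) j≢B)))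

commonBound : ∀ {n} → (Fin n → Vertex) → ℕ
commonBound {zero} f = 0
commonBound {suc n} f = bound (f zero) ⊔ commonBound (f ∘ suc)

bound≤commonBound : ∀ {n} (f : Fin n → Vertex) k → bound (f k) ≤ commonBound f
bound≤commonBound f zero = m≤m⊔n _ _
bound≤commonBound f (suc k) = ≤-trans (bound≤commonBound (f ∘ suc) k) (m≤n⊔m _ _)

module _ {t} (A : TSubset t) where

  private
    f = elt A
    B = commonBound f

    ≉switchedOn : ∀ i w → seq w B ≡ true → ¬ f i ≈ w
    ≉switchedOn i w wB fi≈w = Bool.not-¬ (finite (f i) B (bound≤commonBound f i)) (trans (fi≈w B) wB)

    trace-of-edge : ∀ a b σ → E a b → (∀ i → lookup σ i ≡ true → f i ≈ a ⊎ f i ≈ b) →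
      (∀ i → f i ≈ a ⊎ f i ≈ b → lookup σ i ≡ true) → IsTrace A a b σ
    trace-of-edge a b σ eab to from i = mk⇔ (λ σi → eab , to i σi) (from i ∘ proj₂)

  realized⇒clique : ∀ σ → Realized A σ → IsClique f σ
  realized⇒clique σ (a , b , trace) k l σk σl k≢l with Equivalence.to (trace k) σk | Equivalence.to (trace l) σl
  ... | eab , inj₁ k≈a | _ , inj₁ l≈a = ⊥-elim (k≢l (inj A k l (≈-trans {f k} {a} {f l} k≈a (≈-sym {f l} {a} l≈a))))
  ... | eab , inj₂ k≈b | _ , inj₂ l≈b = ⊥-elim (k≢l (inj A k l (≈-trans {f k} {b} {f l} k≈b (≈-sym {f l} {b} l≈b))))
  ... | eab , inj₁ k≈a | _ , inj₂ l≈b = E-resp-≈ {a} {f k} {b} {f l} (≈-sym {f k} {a} k≈a) (≈-sym {f l} {b} l≈b) eab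
  ... | eab , inj₂ k≈b | _ , inj₁ l≈a = E-resp-≈ {b} {f k} {a} {f l} (≈-sym {f k} {b} k≈b) (≈-sym {f l} {a} l≈a) (E-sym {a} {b} eab)

  clique⇒realized : ∀ σ → IsClique f σ → Realized A σ
  clique⇒realized σ clique with Fin.any? (λ k → lookup σ k Bool.≟ true)
  ... | no empty = a , switchOn a (suc B) , trace-of-edge a (switchOn a (suc B)) σ (E-switchOn a (suc B) ≤-refl)
          (λ i σi → ⊥-elim (empty (i , σi))) from
    where
    a = switchOn origin B
    from : ∀ i → f i ≈ a ⊎ f i ≈ switchOn a (suc B) → lookup σ i ≡ true
    from i (inj₁ i≈a) = ⊥-elim (≉switchedOn i a (switchOn-on origin B) i≈a)
    from i (inj₂ i≈b) = ⊥-elim (≉switchedOn i (switchOn a (suc B)) (switchOn-keeps a (suc B) B (switchOn-on origin B)) i≈b)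
  ... | yes (k , σk) with Fin.any? (λ l → (lookup σ l Bool.≟ true) ×-dec ¬? (l Fin.≟ k))
  ...   | no singleton = f k , switchOn (f k) B , trace-of-edge (f k) (switchOn (f k) B) σ (E-switchOn (f k) B (bound≤commonBound f k)) to from
    where
    to : ∀ i → lookup σ i ≡ true → f i ≈ f k ⊎ f i ≈ switchOn (f k) B
    to i σi with i Fin.≟ k
    ... | yes refl = inj₁ (λ _ → refl)
    ... | no i≢k = ⊥-elim (singleton (i , σi , i≢k))
    from : ∀ i → f i ≈ f k ⊎ f i ≈ switchOn (f k) B → lookup σ i ≡ true
    from i (inj₁ i≈k) rewrite inj A i k i≈k = σk
    from i (inj₂ i≈b) = ⊥-elim (≉switchedOn i (switchOn (f k) B) (switchOn-on (f k) B) i≈b)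
  ...   | yes (l , σl , l≢k) = f k , f l , trace-of-edge (f k) (f l) σ ekl to from
    where
    ekl = clique k l σk σl (l≢k ∘ sym)
    to : ∀ i → lookup σ i ≡ true → f i ≈ f k ⊎ f i ≈ f l
    to i σi with i Fin.≟ k | i Fin.≟ l
    ... | yes refl | _ = inj₁ (λ _ → refl)
    ... | no _ | yes refl = inj₂ (λ _ → refl)
    ... | no i≢k | no i≢l = ⊥-elim (E-triangle-free {f i} {f k} {f l} (clique i k σi σk i≢k) ekl (clique i l σi σl i≢l))
    from : ∀ i → f i ≈ f k ⊎ f i ≈ f l → lookup σ i ≡ true
    from i (inj₁ i≈k) rewrite inj A i k i≈k = σk
    from i (inj₂ i≈l) rewrite inj A i l i≈l = σl

module _ {t} (A : TSubset t) where

  traces : List (Subset t)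
  traces = filterᵇ (isClique (elt A)) (subsets t)

  ∈-traces⁺ : ∀ {σ} → Realized A σ → σ ∈ traces
  ∈-traces⁺ {σ} r = ∈-filter⁺ (T? ∘ isClique (elt A)) (∈-subsets σ) (isClique-complete (elt A) σ (realized⇒clique A σ r))

  ∈-traces⁻ : ∀ {σ} → σ ∈ traces → Realized A σ
  ∈-traces⁻ {σ} σ∈ = clique⇒realized A σ (isClique-sound (elt A) σ (proj₂ (∈-filter⁻ (T? ∘ isClique (elt A)) {xs = subsets t} σ∈)))

  traces-unique : Unique traces
  traces-unique = Uniqueₚ.filter⁺ (T? ∘ isClique (elt A)) (subsets-unique t)

  traceCount-traces : TraceCount A (length traces)
  traceCount-traces = L , L-injective , L-realized , L-complete
    where
    L = Vec.tabulate (List.lookup traces)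
    L-injective : ∀ i j → lookup L i ≡ lookup L j → i ≡ j
    L-injective i j e = AllPairs¬⇒lookup-injective sym traces traces-unique i j
      (trans (sym (Vec.lookup∘tabulate _ i)) (trans e (Vec.lookup∘tabulate _ j)))
    L-realized : ∀ i → Realized A (lookup L i)
    L-realized i rewrite Vec.lookup∘tabulate (List.lookup traces) i = ∈-traces⁻ (∈-lookup i)
    L-complete : ∀ σ → Realized A σ → ∃[ i ] lookup L i ≡ σ
    L-complete σ r = index σ∈ , trans (Vec.lookup∘tabulate _ (index σ∈)) (sym (lookup-index σ∈))
      where σ∈ = ∈-traces⁺ r

  traceCount≤length-traces : ∀ k → TraceCount A k → k ≤ length traces
  traceCount≤length-traces k (L , L-injective , L-realized , _) = Fin.injective⇒≤ position-injective
    where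
    position : Fin k → Fin (length traces)
    position i = index (∈-traces⁺ (L-realized i))
    position-injective : ∀ {i j} → position i ≡ position j → i ≡ j
    position-injective {i} {j} e = L-injective i j (begin
      lookup L i                       ≡⟨ lookup-index (∈-traces⁺ (L-realized i)) ⟩
      List.lookup traces (position i)      ≡⟨ cong (List.lookup traces) e ⟩
      List.lookup traces (position j)      ≡⟨ lookup-index (∈-traces⁺ (L-realized j)) ⟨
      lookup L j                       ∎)
      where open ≡-Reasoning

  length-traces : length traces ≡ suc (t + edgeCount (tabulate (elt A)))
  length-traces = count-cliques (elt A)

-- The shatter function

traceCount≤maxTraceCount : ∀ {t} (A : TSubset t) k → TraceCount A k → k ≤ maxTraceCount t
traceCount≤maxTraceCount {t} A k count = begin
  k                                          ≤⟨ traceCount≤length-traces A k count ⟩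
  length (traces A)                          ≡⟨ length-traces A ⟩
  suc (t + edgeCount (tabulate (elt A)))     ≤⟨ s≤s (+-monoʳ-≤ t harper-bound) ⟩
  suc (t + harper t)                         ∎
  where
  open ≤-Reasoning
  harper-bound : edgeCount (tabulate (elt A)) ≤ harper t
  harper-bound = subst (λ n → edgeCount (tabulate (elt A)) ≤ harper n) (length-tabulate (elt A))
    (edgeCount≤harper (tabulate (elt A)) (AllPairsₚ.tabulate⁺ λ {i} {j} i≢j → i≢j ∘ inj A i j))

traceCount-of-list : ∀ {t} xs → Distinct xs → length xs ≡ t → Σ[ A ∈ TSubset t ] TraceCount A (suc (t + edgeCount xs))
traceCount-of-list xs distinct refl = A , subst (TraceCount A) count (traceCount-traces A)
  where
  A = mkTSubset (List.lookup xs) (AllPairs¬⇒lookup-injective (λ {v} {w} → ≈-sym {v} {w}) xs distinct)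
  count : length (traces A) ≡ suc (length xs + edgeCount xs)
  count = trans (length-traces A) (cong (λ ys → suc (length xs + edgeCount ys)) (tabulate-lookup xs))

maxTraceCount-attained : ∀ t → Σ[ A ∈ TSubset t ] TraceCount A (maxTraceCount t)
maxTraceCount-attained t = subst (λ e → Σ[ A ∈ TSubset t ] TraceCount A (suc (t + e))) (edgeCount-segment t t (n≤2^n t))
  (traceCount-of-list (segment t t) (segment-distinct t t) (length-segment t t (n≤2^n t)))

proposition4p13 : Σ[ π ∈ (ℕ → ℕ) ] ((∀ t → IsShatterMax t (π t)) × HalfTLogT-Asymptotic π)
proposition4p13 = maxTraceCount , (λ t → maxTraceCount-attained t , traceCount≤maxTraceCount) , maxTraceCount-asymptotic
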